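{- For all integers $h \geq 2$ and $k \geq 1$, the $k$th positive element $a_k(h)$ of the greedy $B_h$-set satisfies \[ a_k(h) \leq \sum_{i=0}^{k-1} h^i < h^{k-1} + 2h^{k-2}. \]
   Context: For an integer $h \geq 1$, a set $A$ of nonnegative integers is a $B_h$-set if every integer $n$ has at most one representation $n = a_{i_1} + a_{i_2} + \cdots + a_{i_h}$ with $a_{i_1}, \ldots, a_{i_h} \in A$ and $a_{i_1} \leq a_{i_2} \leq \cdots \leq a_{i_h}$. The greedy $B_h$-set $\{a_0(h), a_1(h), a_2(h), \ldots\}$ is defined inductively: $a_0(h) = 0$, and for $k \geq 1$, given the $B_h$-set $\{a_0(h), \ldots, a_{k-1}(h)\}$ with $a_0(h) < \cdots < a_{k-1}(h)$, $a_k(h)$ is the smallest integer with $a_k(h) > a_{k-1}(h)$ such that $\{a_0(h), \ldots, a_k(h)\}$ is a $B_h$-set; $a_k(h)$ is called the $k$th positive element of the greedy $B_h$-set. -}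

module Defs where

open import Data.Nat using (ℕ; zero; suc; _+_; _*_; _^_; _≤_; _<_)
open import Data.Fin using (Fin; toℕ)
open import Data.Product using (∃; _×_)
open import Data.Sum using (_⊎_)
open import Relation.Binary.PropositionalEquality using (_≡_)
open import Relation.Nullary using (¬_)
import Data.Vec.Functional as VF

Tuple : ℕ → Set
Tuple h = Fin h → ℕ

Sorted : ∀ {h} → Tuple h → Set
Sorted {h} x = ∀ (i j : Fin h) → toℕ i ≤ toℕ j → x i ≤ x j

tsum : ∀ {h} → Tuple h → ℕ
tsum = VF.foldr _+_ 0

IsBh : ℕ → (ℕ → Set) → Set
IsBh h A = ∀ (x y : Tuple h) → Sorted x → Sorted y →
           (∀ i → A (x i)) → (∀ i → A (y i)) →
           tsum x ≡ tsum y → ∀ i → x i ≡ y i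

Upto : (ℕ → ℕ) → ℕ → ℕ → Set
Upto a k n = ∃ λ j → j ≤ k × a j ≡ n

UptoWith : (ℕ → ℕ) → ℕ → ℕ → ℕ → Set
UptoWith a k m n = (∃ λ j → j < k × a j ≡ n) ⊎ n ≡ m

-- a is the greedy B_h-set: a_0 = 0 and, for k ≥ 1, a_k is the smallest
-- integer > a_{k-1} such that {a_0, ..., a_k} is a B_h-set.
IsGreedyBh : ℕ → (ℕ → ℕ) → Set
IsGreedyBh h a =
  a 0 ≡ 0 ×
  (∀ k → a k < a (suc k)) ×
  (∀ k → IsBh h (Upto a (suc k))) ×
  (∀ k m → a k < m → m < a (suc k) → ¬ IsBh h (UptoWith a (suc k) m))

geomSum : ℕ → ℕ → ℕ
geomSum h zero = 0
geomSum h (suc k) = geomSum h k + h ^ k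

-- If {a₀, …, a_k} is a B_h-set with maximum M = a_k, then adjoining any
-- m > hM keeps it a B_h-set: in a sum of h elements the copies of m are
-- counted by the quotient modulo m, because the other summands add up to at
-- most hM < m; replacing each m by M then gives a representation inside
-- {a₀, …, a_k}, which is unique.  Hence the greedy choice gives
-- a_{k+1} ≤ h a_k + 1, and iterating from a₀ = 0 yields
-- a_k ≤ 1 + h + ⋯ + h^{k-1}.
module Submission where

open import Defs
open import Data.Nat using (ℕ; zero; suc; _+_; _*_; _^_; _∸_; _≤_; _<_;
  z≤n; s≤s; z<s; _≤?_; NonZero; >-nonZero)
open import Data.Nat.Properties
open import Data.Nat.DivMod using (_%_; [m+kn]%n≡m%n; m<n⇒m%n≡m)
open import Data.Fin using () renaming (zero to fzero; suc to fsuc)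
open import Data.Product using (_×_; _,_; proj₁; proj₂)
open import Data.Sum using (_⊎_; inj₁; inj₂)
open import Data.Empty using (⊥-elim)
open import Function using (_∘_)
open import Relation.Binary.PropositionalEquality
open import Relation.Nullary using (¬_; yes; no)
open import Algebra.Properties.Semiring.Sum +-*-semiring
  using (sum-cong-≗; ∑-distrib-+; *-distribʳ-sum)

tsum-linear : ∀ {n} (f g : Tuple n) c →
              tsum (λ i → f i + g i * c) ≡ tsum f + tsum g * c
tsum-linear f g c = begin
  tsum (λ i → f i + g i * c)       ≡⟨ ∑-distrib-+ f (λ i → g i * c) ⟩
  tsum f + tsum (λ i → g i * c)    ≡⟨ cong (tsum f +_) (*-distribʳ-sum c g) ⟨
  tsum f + tsum g * c              ∎
  where open ≡-Reasoning

tsum-≤ : ∀ {n} (f : Tuple n) c → (∀ i → f i ≤ c) → tsum f ≤ n * c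
tsum-≤ {zero}  f c f≤c = z≤n
tsum-≤ {suc n} f c f≤c = +-mono-≤ (f≤c fzero) (tsum-≤ (f ∘ fsuc) c (f≤c ∘ fsuc))

tsum-≥ : ∀ {n} (f : Tuple n) c → (∀ i → c ≤ f i) → n * c ≤ tsum f
tsum-≥ {zero}  f c c≤f = z≤n
tsum-≥ {suc n} f c c≤f = +-mono-≤ (c≤f fzero) (tsum-≥ (f ∘ fsuc) c (c≤f ∘ fsuc))

Sorted-tail : ∀ {n} {x : Tuple (suc n)} → Sorted x → Sorted (x ∘ fsuc)
Sorted-tail sorted i j i≤j = sorted (fsuc i) (fsuc j) (s≤s i≤j)

Sorted-map : ∀ {n} {x : Tuple n} (f : ℕ → ℕ) → (∀ {v w} → v ≤ w → f v ≤ f w) →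
             Sorted x → Sorted (f ∘ x)
Sorted-map f f-mono sorted i j i≤j = f-mono (sorted i j i≤j)

Binary : ∀ {n} → Tuple n → Set
Binary x = ∀ i → x i ≤ 1

private
  ≤1-cases : ∀ {v} → v ≤ 1 → v ≡ 0 ⊎ v ≡ 1
  ≤1-cases z≤n       = inj₁ refl
  ≤1-cases (s≤s z≤n) = inj₂ refl

  -- A tuple starting with 1 is all ones, one starting with 0 has a zero.
  head-1<head-0 : ∀ {n} (x y : Tuple (suc n)) → Sorted x → Binary y →
                  x fzero ≡ 1 → y fzero ≡ 0 → tsum y < tsum x
  head-1<head-0 {n} x y x-sorted y-binary x₀≡1 y₀≡0 = begin-strict
    tsum y                      ≡⟨ cong (_+ tsum (y ∘ fsuc)) y₀≡0 ⟩
    tsum (y ∘ fsuc)             ≤⟨ tsum-≤ (y ∘ fsuc) 1 (y-binary ∘ fsuc) ⟩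
    n * 1                       <⟨ n<1+n (n * 1) ⟩
    suc n * 1                   ≤⟨ tsum-≥ x 1 (λ i → subst (_≤ x i) x₀≡1 (x-sorted fzero i z≤n)) ⟩
    tsum x                      ∎
    where open ≤-Reasoning

Sorted-binary-tsum-injective : ∀ {n} (x y : Tuple n) → Sorted x → Sorted y →
                               Binary x → Binary y → tsum x ≡ tsum y → ∀ i → x i ≡ y i
Sorted-binary-tsum-injective {suc n} x y x-sorted y-sorted x-binary y-binary sum≡ =
  by-head (≤1-cases (x-binary fzero)) (≤1-cases (y-binary fzero))
  where
  same-head : x fzero ≡ y fzero → ∀ i → x i ≡ y i
  same-head x₀≡y₀ fzero    = x₀≡y₀
  same-head x₀≡y₀ (fsuc i) =
    Sorted-binary-tsum-injective (x ∘ fsuc) (y ∘ fsuc)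
      (Sorted-tail x-sorted) (Sorted-tail y-sorted) (x-binary ∘ fsuc) (y-binary ∘ fsuc)
      (+-cancelˡ-≡ (x fzero) _ _ (trans sum≡ (cong (_+ tsum (y ∘ fsuc)) (sym x₀≡y₀)))) i

  by-head : x fzero ≡ 0 ⊎ x fzero ≡ 1 → y fzero ≡ 0 ⊎ y fzero ≡ 1 → ∀ i → x i ≡ y i
  by-head (inj₁ x₀≡0) (inj₁ y₀≡0) = same-head (trans x₀≡0 (sym y₀≡0))
  by-head (inj₂ x₀≡1) (inj₂ y₀≡1) = same-head (trans x₀≡1 (sym y₀≡1))
  by-head (inj₂ x₀≡1) (inj₁ y₀≡0) =
    ⊥-elim (<-irrefl (sym sum≡) (head-1<head-0 x y x-sorted y-binary x₀≡1 y₀≡0))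
  by-head (inj₁ x₀≡0) (inj₂ y₀≡1) =
    ⊥-elim (<-irrefl sum≡ (head-1<head-0 y x y-sorted x-binary y₀≡1 x₀≡0))

division-unique : ∀ {m r₁ r₂ q₁ q₂} .{{_ : NonZero m}} → r₁ < m → r₂ < m →
                  r₁ + q₁ * m ≡ r₂ + q₂ * m → r₁ ≡ r₂ × q₁ ≡ q₂
division-unique {m} {r₁} {r₂} {q₁} {q₂} r₁<m r₂<m eq = r₁≡r₂ , q₁≡q₂
  where
  open ≡-Reasoning
  r₁≡r₂ : r₁ ≡ r₂
  r₁≡r₂ = begin
    r₁                  ≡⟨ m<n⇒m%n≡m r₁<m ⟨
    r₁ % m              ≡⟨ [m+kn]%n≡m%n r₁ q₁ m ⟨
    (r₁ + q₁ * m) % m   ≡⟨ cong (_% m) eq ⟩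
    (r₂ + q₂ * m) % m   ≡⟨ [m+kn]%n≡m%n r₂ q₂ m ⟩
    r₂ % m              ≡⟨ m<n⇒m%n≡m r₂<m ⟩
    r₂                  ∎
  q₁≡q₂ : q₁ ≡ q₂
  q₁≡q₂ = *-cancelʳ-≡ q₁ q₂ m (+-cancelˡ-≡ r₁ _ _ (trans eq (cong (_+ q₂ * m) (sym r₁≡r₂))))

IsBh-⊆ : ∀ {h} {A A′ : ℕ → Set} → (∀ {v} → A v → A′ v) → IsBh h A′ → IsBh h A
IsBh-⊆ A⊆A′ A′-bh x y x-sorted y-sorted x∈A y∈A =
  A′-bh x y x-sorted y-sorted (λ i → A⊆A′ (x∈A i)) (λ i → A⊆A′ (y∈A i))

module _ {h M m} {B : ℕ → Set} (B-bh : IsBh h B) (M∈B : B M) (B≤M : ∀ {v} → B v → v ≤ M)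
         (M<m : M < m) (hM<m : h * M < m) where

  private
    instance
      m≢0 : NonZero m
      m≢0 = >-nonZero (≤-<-trans z≤n M<m)

    -- An element v of B ∪ {m} is written as low v + high v * m; replacing
    -- m by M turns it into clamp v = low v + high v * M, which lies in B.
    high low clamp : ℕ → ℕ
    high v with v ≤? M
    ... | yes _ = 0
    ... | no  _ = 1
    low v with v ≤? M
    ... | yes _ = v
    ... | no  _ = 0
    clamp v with v ≤? M
    ... | yes _ = v
    ... | no  _ = M

    high-mono : ∀ {v w} → v ≤ w → high v ≤ high w
    high-mono {v} {w} v≤w with v ≤? M | w ≤? M
    ... | yes _   | _       = z≤n
    ... | no  v≰M | yes w≤M = ⊥-elim (v≰M (≤-trans v≤w w≤M))
    ... | no  _   | no  _   = ≤-refl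

    clamp-mono : ∀ {v w} → v ≤ w → clamp v ≤ clamp w
    clamp-mono {v} {w} v≤w with v ≤? M | w ≤? M
    ... | yes _   | yes _   = v≤w
    ... | yes v≤M | no  _   = v≤M
    ... | no  v≰M | yes w≤M = ⊥-elim (v≰M (≤-trans v≤w w≤M))
    ... | no  _   | no  _   = ≤-refl

    high-binary : ∀ v → high v ≤ 1
    high-binary v with v ≤? M
    ... | yes _ = z≤n
    ... | no  _ = s≤s z≤n

    low≤M : ∀ v → low v ≤ M
    low≤M v with v ≤? M
    ... | yes v≤M = v≤M
    ... | no  _   = z≤n

    low+high*m : ∀ {v} → B v ⊎ v ≡ m → v ≡ low v + high v * m
    low+high*m {v} v∈ with v ≤? M | v∈
    ... | yes _   | _         = sym (+-identityʳ v)
    ... | no  v≰M | inj₁ v∈B  = ⊥-elim (v≰M (B≤M v∈B))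
    ... | no  _   | inj₂ v≡m  = trans v≡m (sym (+-identityʳ m))

    low+high*M : ∀ v → clamp v ≡ low v + high v * M
    low+high*M v with v ≤? M
    ... | yes _ = sym (+-identityʳ v)
    ... | no  _ = sym (+-identityʳ M)

    clamp∈B : ∀ {v} → B v ⊎ v ≡ m → B (clamp v)
    clamp∈B {v} v∈ with v ≤? M | v∈
    ... | no  _   | _         = M∈B
    ... | yes _   | inj₁ v∈B  = v∈B
    ... | yes v≤M | inj₂ v≡m  = ⊥-elim (<-irrefl v≡m (≤-<-trans v≤M M<m))

    tsum-low<m : (x : Tuple h) → tsum (low ∘ x) < m
    tsum-low<m x = ≤-<-trans (tsum-≤ (low ∘ x) M (low≤M ∘ x)) hM<m

  IsBh-insert-large : IsBh h (λ v → B v ⊎ v ≡ m)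
  IsBh-insert-large x y x-sorted y-sorted x∈ y∈ sum≡ i = begin
    x i                          ≡⟨ low+high*m (x∈ i) ⟩
    low (x i) + high (x i) * m   ≡⟨ cong₂ (λ r q → r + q * m) low≡ high≡ ⟩
    low (y i) + high (y i) * m   ≡⟨ low+high*m (y∈ i) ⟨
    y i                          ∎
    where
    open ≡-Reasoning
    split : (z : Tuple h) → (∀ j → B (z j) ⊎ z j ≡ m) →
            tsum z ≡ tsum (low ∘ z) + tsum (high ∘ z) * m
    split z z∈ = trans (sum-cong-≗ (low+high*m ∘ z∈)) (tsum-linear (low ∘ z) (high ∘ z) m)

    tsum-clamp : (z : Tuple h) → tsum (clamp ∘ z) ≡ tsum (low ∘ z) + tsum (high ∘ z) * M
    tsum-clamp z = trans (sum-cong-≗ (low+high*M ∘ z)) (tsum-linear (low ∘ z) (high ∘ z) M)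

    parts≡ : tsum (low ∘ x) ≡ tsum (low ∘ y) × tsum (high ∘ x) ≡ tsum (high ∘ y)
    parts≡ = division-unique (tsum-low<m x) (tsum-low<m y)
               (trans (sym (split x x∈)) (trans sum≡ (split y y∈)))

    clamp≡ : clamp (x i) ≡ clamp (y i)
    clamp≡ = B-bh (clamp ∘ x) (clamp ∘ y)
      (Sorted-map clamp clamp-mono x-sorted) (Sorted-map clamp clamp-mono y-sorted)
      (clamp∈B ∘ x∈) (clamp∈B ∘ y∈)
      (begin
        tsum (clamp ∘ x)                       ≡⟨ tsum-clamp x ⟩
        tsum (low ∘ x) + tsum (high ∘ x) * M   ≡⟨ cong₂ (λ r q → r + q * M)
                                                        (proj₁ parts≡) (proj₂ parts≡) ⟩
        tsum (low ∘ y) + tsum (high ∘ y) * M   ≡⟨ tsum-clamp y ⟨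
        tsum (clamp ∘ y)                       ∎) i

    high≡ : high (x i) ≡ high (y i)
    high≡ = Sorted-binary-tsum-injective (high ∘ x) (high ∘ y)
      (Sorted-map high high-mono x-sorted) (Sorted-map high high-mono y-sorted)
      (high-binary ∘ x) (high-binary ∘ y) (proj₂ parts≡) i

    low≡ : low (x i) ≡ low (y i)
    low≡ = +-cancelʳ-≡ _ _ _ (begin
      low (x i) + high (x i) * M   ≡⟨ low+high*M (x i) ⟨
      clamp (x i)                  ≡⟨ clamp≡ ⟩
      clamp (y i)                  ≡⟨ low+high*M (y i) ⟩
      low (y i) + high (y i) * M   ≡⟨ cong (λ q → low (y i) + q * M) high≡ ⟨
      low (y i) + high (x i) * M   ∎)

geomSum-suc : ∀ h k → h * geomSum h k + 1 ≡ geomSum h (suc k)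
geomSum-suc h zero    = cong (_+ 1) (*-zeroʳ h)
geomSum-suc h (suc k) = begin
  h * (geomSum h k + h ^ k) + 1     ≡⟨ cong (_+ 1) (*-distribˡ-+ h (geomSum h k) (h ^ k)) ⟩
  h * geomSum h k + h ^ suc k + 1   ≡⟨ +-assoc (h * geomSum h k) (h ^ suc k) 1 ⟩
  h * geomSum h k + (h ^ suc k + 1) ≡⟨ cong (h * geomSum h k +_) (+-comm (h ^ suc k) 1) ⟩
  h * geomSum h k + (1 + h ^ suc k) ≡⟨ +-assoc (h * geomSum h k) 1 (h ^ suc k) ⟨
  h * geomSum h k + 1 + h ^ suc k   ≡⟨ cong (_+ h ^ suc k) (geomSum-suc h k) ⟩
  geomSum h (suc k) + h ^ suc k     ∎
  where open ≡-Reasoning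

geomSum<^ : ∀ {h} → 2 ≤ h → ∀ k → geomSum h k < h ^ k
geomSum<^ h≥2 zero    = z<s
geomSum<^ {h} h≥2 (suc k) = begin-strict
  geomSum h k + h ^ k   <⟨ +-monoˡ-< (h ^ k) (geomSum<^ h≥2 k) ⟩
  h ^ k + h ^ k         ≡⟨ cong (h ^ k +_) (+-identityʳ (h ^ k)) ⟨
  2 * h ^ k             ≤⟨ *-monoˡ-≤ (h ^ k) h≥2 ⟩
  h ^ suc k             ∎
  where open ≤-Reasoning

*-geomSum-suc< : ∀ {h} → 2 ≤ h → ∀ k → h * geomSum h (suc k) < h ^ suc k + 2 * h ^ k
*-geomSum-suc< {h} h≥2 k = begin-strict
  h * (geomSum h k + h ^ k)       ≡⟨ *-distribˡ-+ h (geomSum h k) (h ^ k) ⟩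
  h * geomSum h k + h ^ suc k     <⟨ +-monoˡ-< (h ^ suc k) h*geomSum<2*^ ⟩
  2 * h ^ k + h ^ suc k           ≡⟨ +-comm (2 * h ^ k) (h ^ suc k) ⟩
  h ^ suc k + 2 * h ^ k           ∎
  where
  open ≤-Reasoning
  h*geomSum<2*^ : h * geomSum h k < 2 * h ^ k
  h*geomSum<2*^ = begin-strict
    h * geomSum h k           <⟨ m<m+n (h * geomSum h k) z<s ⟩
    h * geomSum h k + 1       ≡⟨ geomSum-suc h k ⟩
    geomSum h k + h ^ k       <⟨ +-monoˡ-< (h ^ k) (geomSum<^ h≥2 k) ⟩
    h ^ k + h ^ k             ≡⟨ cong (h ^ k +_) (+-identityʳ (h ^ k)) ⟨
    2 * h ^ k                 ∎

Upto-⊆-suc : ∀ (a : ℕ → ℕ) {k n} → Upto a k n → Upto a (suc k) n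
Upto-⊆-suc a (j , j≤k , aj≡n) = j , m≤n⇒m≤1+n j≤k , aj≡n

module _ {h} {a : ℕ → ℕ} (greedy : IsGreedyBh h a) where

  private
    a₀≡0 : a 0 ≡ 0
    a₀≡0 = proj₁ greedy

    a-increasing : ∀ k → a k < a (suc k)
    a-increasing = proj₁ (proj₂ greedy)

    Upto-suc-bh : ∀ k → IsBh h (Upto a (suc k))
    Upto-suc-bh = proj₁ (proj₂ (proj₂ greedy))

    greedy-minimal : ∀ k m → a k < m → m < a (suc k) → ¬ IsBh h (UptoWith a (suc k) m)
    greedy-minimal = proj₂ (proj₂ (proj₂ greedy))

  greedy-mono : ∀ {j k} → j ≤ k → a j ≤ a k
  greedy-mono {k = zero}  z≤n = ≤-refl
  greedy-mono {k = suc k} j≤1+k with m≤n⇒m<n∨m≡n j≤1+k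
  ... | inj₁ (s≤s j≤k) = ≤-trans (greedy-mono j≤k) (<⇒≤ (a-increasing k))
  ... | inj₂ refl      = ≤-refl

  greedy-Upto-bh : ∀ k → IsBh h (Upto a k)
  greedy-Upto-bh zero    = IsBh-⊆ {A = Upto a 0} (Upto-⊆-suc a) (Upto-suc-bh 0)
  greedy-Upto-bh (suc k) = Upto-suc-bh k

  -- h a_k + 1 is always an admissible candidate for a_{k+1}.
  greedy-suc≤ : .{{_ : NonZero h}} → ∀ k → a (suc k) ≤ h * a k + 1
  greedy-suc≤ k with a (suc k) ≤? h * a k + 1
  ... | yes a₁₊ₖ≤ = a₁₊ₖ≤
  ... | no  a₁₊ₖ≰ = ⊥-elim (greedy-minimal k (h * a k + 1) a<m (≰⇒> a₁₊ₖ≰) extension-bh)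
    where
    hM<m : h * a k < h * a k + 1
    hM<m = m<m+n (h * a k) z<s
    a<m : a k < h * a k + 1
    a<m = ≤-<-trans (m≤n*m (a k) h) hM<m
    Upto≤ : ∀ {v} → Upto a k v → v ≤ a k
    Upto≤ (j , j≤k , aj≡v) = subst (_≤ a k) aj≡v (greedy-mono j≤k)
    UptoWith⊆ : ∀ {v} → UptoWith a (suc k) (h * a k + 1) v → Upto a k v ⊎ v ≡ h * a k + 1
    UptoWith⊆ (inj₁ (j , s≤s j≤k , aj≡v)) = inj₁ (j , j≤k , aj≡v)
    UptoWith⊆ (inj₂ v≡m)                = inj₂ v≡m
    extension-bh : IsBh h (UptoWith a (suc k) (h * a k + 1))
    extension-bh = IsBh-⊆ {A = UptoWith a (suc k) (h * a k + 1)} UptoWith⊆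
      (IsBh-insert-large {B = Upto a k} (greedy-Upto-bh k) (k , ≤-refl , refl)
        Upto≤ a<m hM<m)

  greedy≤geomSum : .{{_ : NonZero h}} → ∀ k → a k ≤ geomSum h k
  greedy≤geomSum zero    = ≤-reflexive a₀≡0
  greedy≤geomSum (suc k) = begin
    a (suc k)             ≤⟨ greedy-suc≤ k ⟩
    h * a k + 1           ≤⟨ +-monoˡ-≤ 1 (*-monoʳ-≤ h (greedy≤geomSum k)) ⟩
    h * geomSum h k + 1   ≡⟨ geomSum-suc h k ⟩
    geomSum h (suc k)     ∎
    where open ≤-Reasoning

corollary3 : (h : ℕ) → 2 ≤ h → (a : ℕ → ℕ) → IsGreedyBh h a →
    (k : ℕ) → 1 ≤ k →
    a k ≤ geomSum h k × h * geomSum h k < h ^ k + 2 * h ^ (k ∸ 1)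
corollary3 h h≥2 a greedy (suc k) _ =
  greedy≤geomSum greedy {{>-nonZero (<-trans z<s h≥2)}} (suc k) , *-geomSum-suc< h≥2 k
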